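{- Let $\Gamma$ be an environment. If $\Gamma\vdash M:A$ is derivable, then $\mathrm{FV}(M)\subseteq\mathrm{dom}(\Gamma)$, and the following can be derived with typing derivations strictly smaller than the given one: (1) $\Gamma\ \mathsf{wf}$; (2) $\Gamma\vdash A:s$ for some $s\in\mathcal S$, or else $A\in\mathcal S$. If $\Gamma;B\vdash l:C$ is derivable, then $\mathrm{FV}(l)\subseteq\mathrm{dom}(\Gamma)$, and the following can be derived with strictly smaller typing derivations: (1) $\Gamma\ \mathsf{wf}$; (2) $\Gamma\vdash B:s$ and $\Gamma\vdash C:s'$ for some $s,s'\in\mathcal S$.
   Context: Ground PTSC syntax: given sorts $\mathcal S$ and variables, terms $M ::= \Pi x^{A}.B \mid \lambda x^{A}.M \mid s \mid x\,l \mid M\,l \mid \langle N/x\rangle_A M$ and lists $l ::= [\,] \mid M\cdot l \mid l @ l' \mid \langle N/x\rangle_A l$ ($\langle N/x\rangle_A$ explicit substitution binding $x$; $\Pi,\lambda$ bind $x$; up to $\alpha$-conversion). Reduction $\to$ is the contextual closure of: $(\lambda x^A.M)(N\cdot l)\to(\langle N/x\rangle_A M)\,l$; $M\,[\,]\to M$; $(x\,l)\,l'\to x\,(l@l')$; $(M\,l)\,l'\to M\,(l@l')$; $(M\cdot l')@l\to M\cdot(l'@l)$; $[\,]@l\to l$; $(l@l')@l''\to l@(l'@l'')$; $l@[\,]\to l$; $\langle P/y\rangle_G(\lambda x^A.M)\to\lambda x^{\langle P/y\rangle_G A}.\langle P/y\rangle_G M$; $\langle P/y\rangle_G(y\,l)\to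 P\,(\langle P/y\rangle_G l)$; $\langle P/y\rangle_G(x\,l)\to x\,(\langle P/y\rangle_G l)$ ($x\ne y$); $\langle P/y\rangle_G(M\,l)\to(\langle P/y\rangle_G M)(\langle P/y\rangle_G l)$; $\langle P/y\rangle_G(\Pi x^A.B)\to\Pi x^{\langle P/y\rangle_G A}.\langle P/y\rangle_G B$; $\langle P/y\rangle_G s\to s$; $\langle P/y\rangle_G[\,]\to[\,]$; $\langle P/y\rangle_G(M\cdot l)\to(\langle P/y\rangle_G M)\cdot(\langle P/y\rangle_G l)$; $\langle P/y\rangle_G(l@l')\to(\langle P/y\rangle_G l)@(\langle P/y\rangle_G l')$. $\leftrightarrow^*$ is the induced equivalence. A PTSC is given by $\mathcal A\subseteq\mathcal S^2$, $\mathcal R\subseteq\mathcal S^3$. An environment is a list of declarations $(x:A)$; $\mathrm{dom}$ is the list of declared variables; $\langle P/x\rangle_A\Delta$ applies $\langle P/x\rangle_A$ to every type in $\Delta$; $\Gamma\sqsubseteq\Delta$ means for each $(x:A)\in\Gamma$ there is $(x:B)\in\Delta$ with $A\leftrightarrow^*B$. Judgements $\Gamma\ \mathsf{wf}$, $\Gamma\vdash M:A$, $\Gamma;B\vdash l:C$ are derived by: (empty) $\emptyset\ \mathsf{wf}$; (extend) $\Gamma\vdash A:s$, $x\notin\mathrm{dom}\,\Gamma$ $\Rightarrow$ $\Gamma,(x:A)\ \mathsf{wf}$; (sorted) $\Gamma\ \mathsf{wf}$, $(s,s')\in\mathcal A$ $\Rightarrow$ $\Gamma\vdash s:s'$; ($\Pi$wf)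 $\Gamma\vdash A:s_1$, $\Gamma,(x:A)\vdash B:s_2$, $(s_1,s_2,s_3)\in\mathcal R$ $\Rightarrow$ $\Gamma\vdash\Pi x^A.B:s_3$; ($\Pi$R) $\Gamma\vdash\Pi x^A.B:s$, $\Gamma,(x:A)\vdash M:B$ $\Rightarrow$ $\Gamma\vdash\lambda x^A.M:\Pi x^A.B$; (select) $\Gamma;A\vdash l:B$, $(x:A)\in\Gamma$ $\Rightarrow$ $\Gamma\vdash x\,l:B$; (axiom) $\Gamma\vdash A:s$ $\Rightarrow$ $\Gamma;A\vdash[\,]:A$; (conv$_R$) $\Gamma\vdash M:A$, $\Gamma\vdash B:s$, $A\leftrightarrow^*B$ $\Rightarrow$ $\Gamma\vdash M:B$; ($\Pi$L) $\Gamma\vdash\Pi x^A.B:s$, $\Gamma\vdash M:A$, $\Gamma;\langle M/x\rangle_A B\vdash l:C$ $\Rightarrow$ $\Gamma;\Pi x^A.B\vdash M\cdot l:C$; (conv$'_R$) $\Gamma;C\vdash l:A$, $\Gamma\vdash B:s$, $A\leftrightarrow^*B$ $\Rightarrow$ $\Gamma;C\vdash l:B$; (conv$_L$) $\Gamma;A\vdash l:C$, $\Gamma\vdash B:s$, $A\leftrightarrow^*B$ $\Rightarrow$ $\Gamma;B\vdash l:C$; (Cut$_1$) $\Gamma;C\vdash l':A$, $\Gamma;A\vdash l:B$ $\Rightarrow$ $\Gamma;C\vdash l'@l:B$; (Cut$_2$) $\Gamma\vdash P:A$, $\Gamma,(x:A),\Delta;B\vdash l:C$, $\Gamma,\langle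 P/x\rangle_A\Delta\sqsubseteq\Delta'$, $\Delta'\ \mathsf{wf}$ $\Rightarrow$ $\Delta';\langle P/x\rangle_A B\vdash\langle P/x\rangle_A l:\langle P/x\rangle_A C$; (Cut$_3$) $\Gamma\vdash M:A$, $\Gamma;A\vdash l:B$ $\Rightarrow$ $\Gamma\vdash M\,l:B$; (Cut$_4$) $\Gamma\vdash P:A$, $\Gamma,(x:A),\Delta\vdash M:C$, $\Gamma,\langle P/x\rangle_A\Delta\sqsubseteq\Delta'$, $\Delta'\ \mathsf{wf}$ $\Rightarrow$ $\Delta'\vdash\langle P/x\rangle_A M:C'$, where $C'=C$ if $C\in\mathcal S$ and $C'=\langle P/x\rangle_A C$ otherwise. In all rules $s,s',s_i\in\mathcal S$. -}

module Defs where

open import Data.Nat using (ℕ; suc; _+_; _≡ᵇ_)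
open import Data.Bool using (if_then_else_)
open import Data.Product using (Σ; _×_; _,_)
open import Relation.Binary.PropositionalEquality using (_≡_; _≢_)
open import Relation.Nullary using (¬_)
open import Relation.Binary.Construct.Closure.Equivalence using (EqClosure)

record PTSC : Set₁ where
  field
    Sort : Set
    𝒜    : Sort → Sort → Set
    ℛ    : Sort → Sort → Sort → Set

-- Variables are natural numbers (named syntax).
Name : Set
Name = ℕ

-- Ground syntax (raw terms; α-conversion is handled inside ↔*, see below)

mutual
  data Term (𝒫 : PTSC) : Set where
    Π[_∶_]_   : Name → Term 𝒫 → Term 𝒫 → Term 𝒫
    ƛ[_∶_]_   : Name → Term 𝒫 → Term 𝒫 → Term 𝒫
    sort      : PTSC.Sort 𝒫 → Term 𝒫
    _·ᵛ_      : Name → Lst 𝒫 → Term 𝒫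
    _·_       : Term 𝒫 → Lst 𝒫 → Term 𝒫
    ⟨_/_⟩[_]_ : Term 𝒫 → Name → Term 𝒫 → Term 𝒫 → Term 𝒫

  data Lst (𝒫 : PTSC) : Set where
    []ₗ        : Lst 𝒫
    _∷ₗ_       : Term 𝒫 → Lst 𝒫 → Lst 𝒫
    _++ₗ_       : Lst 𝒫 → Lst 𝒫 → Lst 𝒫
    ⟨_/_⟩[_]ₗ_ : Term 𝒫 → Name → Term 𝒫 → Lst 𝒫 → Lst 𝒫

module _ {𝒫 : PTSC} where
  open PTSC 𝒫

  mutual
    data _∈FV_ (z : Name) : Term 𝒫 → Set where
      fv-Π₁ : ∀ {x A B} → z ∈FV A → z ∈FV (Π[ x ∶ A ] B)
      fv-Π₂ : ∀ {x A B} → z ≢ x → z ∈FV B → z ∈FV (Π[ x ∶ A ] B)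
      fv-λ₁ : ∀ {x A M} → z ∈FV A → z ∈FV (ƛ[ x ∶ A ] M)
      fv-λ₂ : ∀ {x A M} → z ≢ x → z ∈FV M → z ∈FV (ƛ[ x ∶ A ] M)
      fv-x  : ∀ {l} → z ∈FV (z ·ᵛ l)
      fv-xl : ∀ {x l} → z ∈FVₗ l → z ∈FV (x ·ᵛ l)
      fv-M₁ : ∀ {M l} → z ∈FV M → z ∈FV (M · l)
      fv-M₂ : ∀ {M l} → z ∈FVₗ l → z ∈FV (M · l)
      fv-s₁ : ∀ {N x A M} → z ∈FV N → z ∈FV (⟨ N / x ⟩[ A ] M)
      fv-s₂ : ∀ {N x A M} → z ∈FV A → z ∈FV (⟨ N / x ⟩[ A ] M)
      fv-s₃ : ∀ {N x A M} → z ≢ x → z ∈FV M → z ∈FV (⟨ N / x ⟩[ A ] M)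

    data _∈FVₗ_ (z : Name) : Lst 𝒫 → Set where
      fv-c₁ : ∀ {M l} → z ∈FV M → z ∈FVₗ (M ∷ₗ l)
      fv-c₂ : ∀ {M l} → z ∈FVₗ l → z ∈FVₗ (M ∷ₗ l)
      fv-++₁ : ∀ {l l'} → z ∈FVₗ l → z ∈FVₗ (l ++ₗ l')
      fv-++₂ : ∀ {l l'} → z ∈FVₗ l' → z ∈FVₗ (l ++ₗ l')
      fv-s₁ : ∀ {N x A l} → z ∈FV N → z ∈FVₗ (⟨ N / x ⟩[ A ]ₗ l)
      fv-s₂ : ∀ {N x A l} → z ∈FV A → z ∈FVₗ (⟨ N / x ⟩[ A ]ₗ l)
      fv-s₃ : ∀ {N x A l} → z ≢ x → z ∈FVₗ l → z ∈FVₗ (⟨ N / x ⟩[ A ]ₗ l)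

  swapN : Name → Name → Name → Name
  swapN x y z = if z ≡ᵇ x then y else (if z ≡ᵇ y then x else z)

  mutual
    swapT : Name → Name → Term 𝒫 → Term 𝒫
    swapT x y (Π[ z ∶ A ] B)     = Π[ swapN x y z ∶ swapT x y A ] swapT x y B
    swapT x y (ƛ[ z ∶ A ] M)     = ƛ[ swapN x y z ∶ swapT x y A ] swapT x y M
    swapT x y (sort s)           = sort s
    swapT x y (z ·ᵛ l)           = swapN x y z ·ᵛ swapL x y l
    swapT x y (M · l)            = swapT x y M · swapL x y l
    swapT x y (⟨ N / z ⟩[ A ] M) = ⟨ swapT x y N / swapN x y z ⟩[ swapT x y A ] swapT x y M

    swapL : Name → Name → Lst 𝒫 → Lst 𝒫
    swapL x y []ₗ                 = []ₗ
    swapL x y (M ∷ₗ l)            = swapT x y M ∷ₗ swapL x y l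
    swapL x y (l ++ₗ l')           = swapL x y l ++ₗ swapL x y l'
    swapL x y (⟨ N / z ⟩[ A ]ₗ l) = ⟨ swapT x y N / swapN x y z ⟩[ swapT x y A ]ₗ swapL x y l

  -- Rules that push an explicit substitution under a binder carry the usual
  -- capture-avoidance side conditions (Barendregt convention).

  data RootT : Term 𝒫 → Term 𝒫 → Set where
    α-Π : ∀ {x y A B} → ¬ (y ∈FV B) → RootT (Π[ x ∶ A ] B) (Π[ y ∶ A ] swapT x y B)
    α-λ : ∀ {x y A M} → ¬ (y ∈FV M) → RootT (ƛ[ x ∶ A ] M) (ƛ[ y ∶ A ] swapT x y M)
    α-s : ∀ {N x y A M} → ¬ (y ∈FV M) →
          RootT (⟨ N / x ⟩[ A ] M) (⟨ N / y ⟩[ A ] swapT x y M)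
    β    : ∀ {x A M N l} → RootT ((ƛ[ x ∶ A ] M) · (N ∷ₗ l)) ((⟨ N / x ⟩[ A ] M) · l)
    app[] : ∀ {M} → RootT (M · []ₗ) M
    appx  : ∀ {x l l'} → RootT ((x ·ᵛ l) · l') (x ·ᵛ (l ++ₗ l'))
    appM  : ∀ {M l l'} → RootT ((M · l) · l') (M · (l ++ₗ l'))
    sλ : ∀ {P y G x A M} → x ≢ y → ¬ (x ∈FV P) → ¬ (x ∈FV G) →
         RootT (⟨ P / y ⟩[ G ] (ƛ[ x ∶ A ] M)) (ƛ[ x ∶ ⟨ P / y ⟩[ G ] A ] (⟨ P / y ⟩[ G ] M))
    sy : ∀ {P y G l} → RootT (⟨ P / y ⟩[ G ] (y ·ᵛ l)) (P · (⟨ P / y ⟩[ G ]ₗ l))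
    sx : ∀ {P y G x l} → x ≢ y → RootT (⟨ P / y ⟩[ G ] (x ·ᵛ l)) (x ·ᵛ (⟨ P / y ⟩[ G ]ₗ l))
    sM : ∀ {P y G M l} →
         RootT (⟨ P / y ⟩[ G ] (M · l)) ((⟨ P / y ⟩[ G ] M) · (⟨ P / y ⟩[ G ]ₗ l))
    sΠ : ∀ {P y G x A B} → x ≢ y → ¬ (x ∈FV P) → ¬ (x ∈FV G) →
         RootT (⟨ P / y ⟩[ G ] (Π[ x ∶ A ] B)) (Π[ x ∶ ⟨ P / y ⟩[ G ] A ] (⟨ P / y ⟩[ G ] B))
    ss : ∀ {P y G s} → RootT (⟨ P / y ⟩[ G ] sort s) (sort s)

  data RootL : Lst 𝒫 → Lst 𝒫 → Set where
    α-sₗ : ∀ {N x y A l} → ¬ (y ∈FVₗ l) →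
           RootL (⟨ N / x ⟩[ A ]ₗ l) (⟨ N / y ⟩[ A ]ₗ swapL x y l)
    ++∷  : ∀ {M l' l} → RootL ((M ∷ₗ l') ++ₗ l) (M ∷ₗ (l' ++ₗ l))
    ++[] : ∀ {l} → RootL ([]ₗ ++ₗ l) l
    ++++  : ∀ {l l' l''} → RootL ((l ++ₗ l') ++ₗ l'') (l ++ₗ (l' ++ₗ l''))
    ++[]ʳ : ∀ {l} → RootL (l ++ₗ []ₗ) l
    s[] : ∀ {P y G} → RootL (⟨ P / y ⟩[ G ]ₗ []ₗ) []ₗ
    s∷  : ∀ {P y G M l} →
          RootL (⟨ P / y ⟩[ G ]ₗ (M ∷ₗ l)) ((⟨ P / y ⟩[ G ] M) ∷ₗ (⟨ P / y ⟩[ G ]ₗ l))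
    s++  : ∀ {P y G l l'} →
          RootL (⟨ P / y ⟩[ G ]ₗ (l ++ₗ l')) ((⟨ P / y ⟩[ G ]ₗ l) ++ₗ (⟨ P / y ⟩[ G ]ₗ l'))

  mutual
    data _⟶_ : Term 𝒫 → Term 𝒫 → Set where
      root : ∀ {M N} → RootT M N → M ⟶ N
      Π₁ : ∀ {x A A' B} → A ⟶ A' → (Π[ x ∶ A ] B) ⟶ (Π[ x ∶ A' ] B)
      Π₂ : ∀ {x A B B'} → B ⟶ B' → (Π[ x ∶ A ] B) ⟶ (Π[ x ∶ A ] B')
      λ₁ : ∀ {x A A' M} → A ⟶ A' → (ƛ[ x ∶ A ] M) ⟶ (ƛ[ x ∶ A' ] M)
      λ₂ : ∀ {x A M M'} → M ⟶ M' → (ƛ[ x ∶ A ] M) ⟶ (ƛ[ x ∶ A ] M')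
      xl : ∀ {x l l'} → l ⟶ₗ l' → (x ·ᵛ l) ⟶ (x ·ᵛ l')
      Ml₁ : ∀ {M M' l} → M ⟶ M' → (M · l) ⟶ (M' · l)
      Ml₂ : ∀ {M l l'} → l ⟶ₗ l' → (M · l) ⟶ (M · l')
      es₁ : ∀ {N N' x A M} → N ⟶ N' → (⟨ N / x ⟩[ A ] M) ⟶ (⟨ N' / x ⟩[ A ] M)
      es₂ : ∀ {N x A A' M} → A ⟶ A' → (⟨ N / x ⟩[ A ] M) ⟶ (⟨ N / x ⟩[ A' ] M)
      es₃ : ∀ {N x A M M'} → M ⟶ M' → (⟨ N / x ⟩[ A ] M) ⟶ (⟨ N / x ⟩[ A ] M')

    data _⟶ₗ_ : Lst 𝒫 → Lst 𝒫 → Set where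
      rootₗ : ∀ {l l'} → RootL l l' → l ⟶ₗ l'
      ∷₁ : ∀ {M M' l} → M ⟶ M' → (M ∷ₗ l) ⟶ₗ (M' ∷ₗ l)
      ∷₂ : ∀ {M l l'} → l ⟶ₗ l' → (M ∷ₗ l) ⟶ₗ (M ∷ₗ l')
      ++₁ : ∀ {l₁ l₁' l₂} → l₁ ⟶ₗ l₁' → (l₁ ++ₗ l₂) ⟶ₗ (l₁' ++ₗ l₂)
      ++₂ : ∀ {l₁ l₂ l₂'} → l₂ ⟶ₗ l₂' → (l₁ ++ₗ l₂) ⟶ₗ (l₁ ++ₗ l₂')
      es₁ : ∀ {N N' x A l} → N ⟶ N' → (⟨ N / x ⟩[ A ]ₗ l) ⟶ₗ (⟨ N' / x ⟩[ A ]ₗ l)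
      es₂ : ∀ {N x A A' l} → A ⟶ A' → (⟨ N / x ⟩[ A ]ₗ l) ⟶ₗ (⟨ N / x ⟩[ A' ]ₗ l)
      es₃ : ∀ {N x A l l'} → l ⟶ₗ l' → (⟨ N / x ⟩[ A ]ₗ l) ⟶ₗ (⟨ N / x ⟩[ A ]ₗ l')

  _↔*_ : Term 𝒫 → Term 𝒫 → Set
  _↔*_ = EqClosure _⟶_

  infixl 5 _,_∶_
  data Env : Set where
    ∅     : Env
    _,_∶_ : Env → Name → Term 𝒫 → Env

  _⧺_ : Env → Env → Env
  Γ ⧺ ∅           = Γ
  Γ ⧺ (Δ , x ∶ A) = (Γ ⧺ Δ) , x ∶ A

  data _∶_∈_ (x : Name) (A : Term 𝒫) : Env → Set where
    here  : ∀ {Γ} → x ∶ A ∈ (Γ , x ∶ A)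
    there : ∀ {Γ y B} → x ∶ A ∈ Γ → x ∶ A ∈ (Γ , y ∶ B)

  data _∈dom_ (x : Name) : Env → Set where
    here  : ∀ {Γ A} → x ∈dom (Γ , x ∶ A)
    there : ∀ {Γ y B} → x ∈dom Γ → x ∈dom (Γ , y ∶ B)

  substEnv : Term 𝒫 → Name → Term 𝒫 → Env → Env
  substEnv P x A ∅           = ∅
  substEnv P x A (Δ , y ∶ B) = substEnv P x A Δ , y ∶ (⟨ P / x ⟩[ A ] B)

  _⊑_ : Env → Env → Set
  Γ ⊑ Δ = ∀ {x A} → x ∶ A ∈ Γ → Σ (Term 𝒫) λ B → (x ∶ B ∈ Δ) × (A ↔* B)

  substTy : Term 𝒫 → Name → Term 𝒫 → Term 𝒫 → Term 𝒫
  substTy P x A (sort s) = sort s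
  substTy P x A C        = ⟨ P / x ⟩[ A ] C

  IsSort : Term 𝒫 → Set
  IsSort A = Σ Sort λ s → A ≡ sort s

  _⊆domₜ_ : Term 𝒫 → Env → Set
  M ⊆domₜ Γ = ∀ {z} → z ∈FV M → z ∈dom Γ

  _⊆domₗ_ : Lst 𝒫 → Env → Set
  l ⊆domₗ Γ = ∀ {z} → z ∈FVₗ l → z ∈dom Γ

  infix 3 _wf _⊢_∶_ _⍮_⊢_∶_
  mutual
    data _wf : Env → Set where
      empty  : ∅ wf
      extend : ∀ {Γ x A s} → Γ ⊢ A ∶ sort s → ¬ (x ∈dom Γ) → (Γ , x ∶ A) wf

    data _⊢_∶_ : Env → Term 𝒫 → Term 𝒫 → Set where
      sorted : ∀ {Γ s s'} → Γ wf → 𝒜 s s' → Γ ⊢ sort s ∶ sort s'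
      Πwf    : ∀ {Γ x A B s₁ s₂ s₃} → Γ ⊢ A ∶ sort s₁ → (Γ , x ∶ A) ⊢ B ∶ sort s₂ →
               ℛ s₁ s₂ s₃ → Γ ⊢ Π[ x ∶ A ] B ∶ sort s₃
      ΠR     : ∀ {Γ x A B M s} → Γ ⊢ Π[ x ∶ A ] B ∶ sort s → (Γ , x ∶ A) ⊢ M ∶ B →
               Γ ⊢ ƛ[ x ∶ A ] M ∶ Π[ x ∶ A ] B
      select : ∀ {Γ x A l B} → Γ ⍮ A ⊢ l ∶ B → x ∶ A ∈ Γ → Γ ⊢ x ·ᵛ l ∶ B
      convR  : ∀ {Γ M A B s} → Γ ⊢ M ∶ A → Γ ⊢ B ∶ sort s → A ↔* B → Γ ⊢ M ∶ B
      Cut₃   : ∀ {Γ M A l B} → Γ ⊢ M ∶ A → Γ ⍮ A ⊢ l ∶ B → Γ ⊢ M · l ∶ B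
      Cut₄   : ∀ {Γ Δ Δ' P x A M C} → Γ ⊢ P ∶ A → ((Γ , x ∶ A) ⧺ Δ) ⊢ M ∶ C →
               (Γ ⧺ substEnv P x A Δ) ⊑ Δ' → Δ' wf →
               Δ' ⊢ ⟨ P / x ⟩[ A ] M ∶ substTy P x A C

    data _⍮_⊢_∶_ : Env → Term 𝒫 → Lst 𝒫 → Term 𝒫 → Set where
      axiom  : ∀ {Γ A s} → Γ ⊢ A ∶ sort s → Γ ⍮ A ⊢ []ₗ ∶ A
      ΠL     : ∀ {Γ x A B M l C s} → Γ ⊢ Π[ x ∶ A ] B ∶ sort s → Γ ⊢ M ∶ A →
               Γ ⍮ ⟨ M / x ⟩[ A ] B ⊢ l ∶ C → Γ ⍮ Π[ x ∶ A ] B ⊢ M ∷ₗ l ∶ C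
      convR' : ∀ {Γ C l A B s} → Γ ⍮ C ⊢ l ∶ A → Γ ⊢ B ∶ sort s → A ↔* B → Γ ⍮ C ⊢ l ∶ B
      convL  : ∀ {Γ A l C B s} → Γ ⍮ A ⊢ l ∶ C → Γ ⊢ B ∶ sort s → A ↔* B → Γ ⍮ B ⊢ l ∶ C
      Cut₁   : ∀ {Γ C l' A l B} → Γ ⍮ C ⊢ l' ∶ A → Γ ⍮ A ⊢ l ∶ B → Γ ⍮ C ⊢ l' ++ₗ l ∶ B
      Cut₂   : ∀ {Γ Δ Δ' P x A B l C} → Γ ⊢ P ∶ A → ((Γ , x ∶ A) ⧺ Δ) ⍮ B ⊢ l ∶ C →
               (Γ ⧺ substEnv P x A Δ) ⊑ Δ' → Δ' wf →
               Δ' ⍮ ⟨ P / x ⟩[ A ] B ⊢ ⟨ P / x ⟩[ A ]ₗ l ∶ ⟨ P / x ⟩[ A ] C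

  mutual
    size-wf : ∀ {Γ} → Γ wf → ℕ
    size-wf empty          = 1
    size-wf (extend d _)   = suc (size-⊢ d)

    size-⊢ : ∀ {Γ M A} → Γ ⊢ M ∶ A → ℕ
    size-⊢ (sorted w _)       = suc (size-wf w)
    size-⊢ (Πwf d e _)        = suc (size-⊢ d + size-⊢ e)
    size-⊢ (ΠR d e)           = suc (size-⊢ d + size-⊢ e)
    size-⊢ (select d _)       = suc (size-⍮ d)
    size-⊢ (convR d e _)      = suc (size-⊢ d + size-⊢ e)
    size-⊢ (Cut₃ d e)         = suc (size-⊢ d + size-⍮ e)
    size-⊢ (Cut₄ d e _ w)     = suc (size-⊢ d + size-⊢ e + size-wf w)

    size-⍮ : ∀ {Γ B l C} → Γ ⍮ B ⊢ l ∶ C → ℕ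
    size-⍮ (axiom d)          = suc (size-⊢ d)
    size-⍮ (ΠL d e f)         = suc (size-⊢ d + size-⊢ e + size-⍮ f)
    size-⍮ (convR' d e _)     = suc (size-⍮ d + size-⊢ e)
    size-⍮ (convL d e _)      = suc (size-⍮ d + size-⊢ e)
    size-⍮ (Cut₁ d e)         = suc (size-⍮ d + size-⍮ e)
    size-⍮ (Cut₂ d e _ w)     = suc (size-⊢ d + size-⍮ e + size-wf w)

module Submission where

open import Defs
open import Data.Nat using (ℕ; suc; _+_; _<_; s≤s)
open import Data.Nat.Properties using (n<1+n; m≤m+n; m≤n+m; ≤-trans; <-trans; +-monoʳ-<; +-monoˡ-<)
open import Data.Product using (Σ; _×_; _,_; proj₁; proj₂)
open import Data.Sum using (_⊎_; inj₁; inj₂)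
open import Data.Empty using (⊥-elim)
open import Relation.Binary.PropositionalEquality using (_≡_; _≢_; refl; sym; subst)

-- Every premise of an inference rule is a strictly smaller derivation, and
-- every rule except (sorted), (Πwf) and the cut rules has, among its
-- premises, a derivation of the well-formedness of the context or of the
-- sorting of the types involved (for (select), (Cut₃) this goes through the
-- list premise).  So the theorem is proved by structural induction on
-- derivations, in three independent parts:
--   * scoping: the free variables of the subject AND of the types of a
--     judgement lie in the domain of its context (the types are needed to
--     handle the cut rules, whose conclusion mentions the type A of P);
--   * well-formedness of the context, by a strictly smaller derivation;
--   * sorting of the types, by a strictly smaller derivation, where for the
--     cut rules a sorting of C in the extended context is re-cut with the
--     same P, giving a sorting of ⟨P/x⟩_A C smaller than the original cut.

module _ {𝒫 : PTSC} where
  open PTSC 𝒫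

  premise₁/₂ : ∀ a b → a < suc (a + b)
  premise₁/₂ a b = s≤s (m≤m+n a b)

  premise₂/₂ : ∀ a b → b < suc (a + b)
  premise₂/₂ a b = s≤s (m≤n+m b a)

  premise₁/₃ : ∀ a b c → a < suc (a + b + c)
  premise₁/₃ a b c = s≤s (≤-trans (m≤m+n a b) (m≤m+n (a + b) c))

  premise₃/₃ : ∀ a b c → c < suc (a + b + c)
  premise₃/₃ a b c = s≤s (m≤n+m c (a + b))

  smaller-cut : ∀ a {b' b} c → b' < b → suc (a + b' + c) < suc (a + b + c)
  smaller-cut a c b'<b = s≤s (+-monoˡ-< c (+-monoʳ-< a b'<b))

  SmallerWf : Env {𝒫} → ℕ → Set
  SmallerWf Γ n = Σ (Γ wf) λ w → size-wf w < n

  SmallerSorting : Env {𝒫} → Term 𝒫 → ℕ → Set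
  SmallerSorting Γ A n = Σ Sort λ s → Σ (Γ ⊢ A ∶ sort s) λ e → size-⊢ e < n

  raise-wf : ∀ {Γ m n} → SmallerWf Γ m → m < n → SmallerWf Γ n
  raise-wf (w , w<m) m<n = w , <-trans w<m m<n

  raise-sorting : ∀ {Γ A m n} → SmallerSorting Γ A m → m < n → SmallerSorting Γ A n
  raise-sorting (s , e , e<m) m<n = s , e , <-trans e<m m<n

  declared⇒∈dom : ∀ {z B} {Γ : Env {𝒫}} → z ∶ B ∈ Γ → z ∈dom Γ
  declared⇒∈dom here      = here
  declared⇒∈dom (there p) = there (declared⇒∈dom p)

  ∈dom⇒declared : ∀ {z} {Γ : Env {𝒫}} → z ∈dom Γ → Σ (Term 𝒫) λ B → z ∶ B ∈ Γ
  ∈dom⇒declared here      = _ , here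
  ∈dom⇒declared (there p) = let (B , q) = ∈dom⇒declared p in B , there q

  ⊑-dom : ∀ {Γ Δ : Env {𝒫}} {z} → Γ ⊑ Δ → z ∈dom Γ → z ∈dom Δ
  ⊑-dom Γ⊑Δ z∈Γ = declared⇒∈dom (proj₁ (proj₂ (Γ⊑Δ (proj₂ (∈dom⇒declared z∈Γ)))))

  ∈dom-⧺ : ∀ {z} {Γ : Env {𝒫}} Δ → z ∈dom Γ → z ∈dom (Γ ⧺ Δ)
  ∈dom-⧺ ∅           p = p
  ∈dom-⧺ (Δ , _ ∶ _) p = there (∈dom-⧺ Δ p)

  ∈dom-pop : ∀ {Γ : Env {𝒫}} {x A z} → z ∈dom (Γ , x ∶ A) → z ≢ x → z ∈dom Γ
  ∈dom-pop here      z≢x = ⊥-elim (z≢x refl)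
  ∈dom-pop (there p) _   = p

  ∈dom-cut : ∀ {Γ : Env {𝒫}} {P x A z} Δ → z ∈dom ((Γ , x ∶ A) ⧺ Δ) → z ≢ x →
             z ∈dom (Γ ⧺ substEnv P x A Δ)
  ∈dom-cut ∅           p         z≢x = ∈dom-pop p z≢x
  ∈dom-cut (Δ , _ ∶ _) here      _   = here
  ∈dom-cut (Δ , _ ∶ _) (there p) z≢x = there (∈dom-cut Δ p z≢x)

  module _ {Γ Δ Δ' : Env {𝒫}} {P x A}
           (P⊆Γ : P ⊆domₜ Γ) (A⊆Γ : A ⊆domₜ Γ) (Γ⊑Δ' : (Γ ⧺ substEnv P x A Δ) ⊑ Δ') where

    outer⊆Δ' : ∀ {z} → z ∈dom Γ → z ∈dom Δ'
    outer⊆Δ' p = ⊑-dom Γ⊑Δ' (∈dom-⧺ (substEnv P x A Δ) p)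

    inner⊆Δ' : ∀ {z} → z ∈dom ((Γ , x ∶ A) ⧺ Δ) → z ≢ x → z ∈dom Δ'
    inner⊆Δ' p z≢x = ⊑-dom Γ⊑Δ' (∈dom-cut Δ p z≢x)

    cut-scope : ∀ {M} → M ⊆domₜ ((Γ , x ∶ A) ⧺ Δ) → (⟨ P / x ⟩[ A ] M) ⊆domₜ Δ'
    cut-scope M⊆ (fv-s₁ p)     = outer⊆Δ' (P⊆Γ p)
    cut-scope M⊆ (fv-s₂ p)     = outer⊆Δ' (A⊆Γ p)
    cut-scope M⊆ (fv-s₃ z≢x p) = inner⊆Δ' (M⊆ p) z≢x

    cut-scopeₗ : ∀ {l} → l ⊆domₗ ((Γ , x ∶ A) ⧺ Δ) → (⟨ P / x ⟩[ A ]ₗ l) ⊆domₗ Δ'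
    cut-scopeₗ l⊆ (fv-s₁ p)     = outer⊆Δ' (P⊆Γ p)
    cut-scopeₗ l⊆ (fv-s₂ p)     = outer⊆Δ' (A⊆Γ p)
    cut-scopeₗ l⊆ (fv-s₃ z≢x p) = inner⊆Δ' (l⊆ p) z≢x

  data SortView : Term 𝒫 → Set where
    sort-view  : ∀ s → SortView (sort s)
    other-view : ∀ {C} → (∀ P x A → substTy P x A C ≡ ⟨ P / x ⟩[ A ] C) → SortView C

  sortView : ∀ C → SortView C
  sortView (sort s)           = sort-view s
  sortView (Π[ _ ∶ _ ] _)     = other-view λ _ _ _ → refl
  sortView (ƛ[ _ ∶ _ ] _)     = other-view λ _ _ _ → refl
  sortView (_ ·ᵛ _)           = other-view λ _ _ _ → refl
  sortView (_ · _)            = other-view λ _ _ _ → refl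
  sortView (⟨ _ / _ ⟩[ _ ] _) = other-view λ _ _ _ → refl

  substTy-scope : ∀ {Γ : Env {𝒫}} {P x A} C →
                  (⟨ P / x ⟩[ A ] C) ⊆domₜ Γ → substTy P x A C ⊆domₜ Γ
  substTy-scope {P = P} {x} {A} C C⊆ with sortView C
  ... | sort-view s  = λ ()
  ... | other-view eq = λ p → C⊆ (subst (_ ∈FV_) (eq P x A) p)

  mutual
    term-scope : ∀ {Γ M A} → Γ ⊢ M ∶ A → M ⊆domₜ Γ
    term-scope (sorted _ _)     ()
    term-scope (Πwf d e _)      (fv-Π₁ p)     = term-scope d p
    term-scope (Πwf d e _)      (fv-Π₂ z≢x p) = ∈dom-pop (term-scope e p) z≢x
    term-scope (ΠR d e)         (fv-λ₁ p)     = term-scope d (fv-Π₁ p)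
    term-scope (ΠR d e)         (fv-λ₂ z≢x p) = ∈dom-pop (term-scope e p) z≢x
    term-scope (select d x∈Γ)   fv-x          = declared⇒∈dom x∈Γ
    term-scope (select d x∈Γ)   (fv-xl p)     = list-scope d p
    term-scope (convR d _ _)    p             = term-scope d p
    term-scope (Cut₃ d e)       (fv-M₁ p)     = term-scope d p
    term-scope (Cut₃ d e)       (fv-M₂ p)     = list-scope e p
    term-scope (Cut₄ d e sub _) p = cut-scope (term-scope d) (type-scope d) sub (term-scope e) p

    type-scope : ∀ {Γ M A} → Γ ⊢ M ∶ A → A ⊆domₜ Γ
    type-scope (sorted _ _)     ()
    type-scope (Πwf _ _ _)      ()
    type-scope (ΠR d _)         = term-scope d
    type-scope (select d _)     = target-scope d
    type-scope (convR _ e _)    = term-scope e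
    type-scope (Cut₃ _ e)       = target-scope e
    type-scope (Cut₄ {C = C} d e sub _) =
      substTy-scope C (cut-scope (term-scope d) (type-scope d) sub (type-scope e))

    list-scope : ∀ {Γ B l C} → Γ ⍮ B ⊢ l ∶ C → l ⊆domₗ Γ
    list-scope (axiom _)        ()
    list-scope (ΠL _ e f)       (fv-c₁ p)  = term-scope e p
    list-scope (ΠL _ e f)       (fv-c₂ p)  = list-scope f p
    list-scope (convR' d _ _)   p          = list-scope d p
    list-scope (convL d _ _)    p          = list-scope d p
    list-scope (Cut₁ d e)       (fv-++₁ p) = list-scope d p
    list-scope (Cut₁ d e)       (fv-++₂ p) = list-scope e p
    list-scope (Cut₂ d e sub _) p = cut-scopeₗ (term-scope d) (type-scope d) sub (list-scope e) p

    source-scope : ∀ {Γ B l C} → Γ ⍮ B ⊢ l ∶ C → B ⊆domₜ Γ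
    source-scope (axiom d)        = term-scope d
    source-scope (ΠL d _ _)       = term-scope d
    source-scope (convR' d _ _)   = source-scope d
    source-scope (convL _ e _)    = term-scope e
    source-scope (Cut₁ d _)       = source-scope d
    source-scope (Cut₂ d e sub _) = cut-scope (term-scope d) (type-scope d) sub (source-scope e)

    target-scope : ∀ {Γ B l C} → Γ ⍮ B ⊢ l ∶ C → C ⊆domₜ Γ
    target-scope (axiom d)        = term-scope d
    target-scope (ΠL _ _ f)       = target-scope f
    target-scope (convR' _ e _)   = term-scope e
    target-scope (convL d _ _)    = target-scope d
    target-scope (Cut₁ _ e)       = target-scope e
    target-scope (Cut₂ d e sub _) = cut-scope (term-scope d) (type-scope d) sub (target-scope e)

  -- Well-formedness of the context, by a strictly smaller derivation: it is a
  -- premise of (sorted) and the cut rules, and is inherited from the first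
  -- premise otherwise.

  mutual
    term-wf : ∀ {Γ M A} (d : Γ ⊢ M ∶ A) → SmallerWf Γ (size-⊢ d)
    term-wf (sorted w _)      = w , n<1+n (size-wf w)
    term-wf (Πwf d e _)       = raise-wf (term-wf d) (premise₁/₂ (size-⊢ d) (size-⊢ e))
    term-wf (ΠR d e)          = raise-wf (term-wf d) (premise₁/₂ (size-⊢ d) (size-⊢ e))
    term-wf (select d _)      = raise-wf (list-wf d) (n<1+n (size-⍮ d))
    term-wf (convR d e _)     = raise-wf (term-wf d) (premise₁/₂ (size-⊢ d) (size-⊢ e))
    term-wf (Cut₃ d e)        = raise-wf (term-wf d) (premise₁/₂ (size-⊢ d) (size-⍮ e))
    term-wf (Cut₄ d e _ w)    = w , premise₃/₃ (size-⊢ d) (size-⊢ e) (size-wf w)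

    list-wf : ∀ {Γ B l C} (d : Γ ⍮ B ⊢ l ∶ C) → SmallerWf Γ (size-⍮ d)
    list-wf (axiom d)         = raise-wf (term-wf d) (n<1+n (size-⊢ d))
    list-wf (ΠL d e f)        = raise-wf (term-wf d) (premise₁/₃ (size-⊢ d) (size-⊢ e) (size-⍮ f))
    list-wf (convR' d e _)    = raise-wf (list-wf d) (premise₁/₂ (size-⍮ d) (size-⊢ e))
    list-wf (convL d e _)     = raise-wf (list-wf d) (premise₁/₂ (size-⍮ d) (size-⊢ e))
    list-wf (Cut₁ d e)        = raise-wf (list-wf d) (premise₁/₂ (size-⍮ d) (size-⍮ e))
    list-wf (Cut₂ d e _ w)    = w , premise₃/₃ (size-⊢ d) (size-⍮ e) (size-wf w)

  re-cut : ∀ {Γ Δ Δ' P x A C n} (d : Γ ⊢ P ∶ A) (sub : (Γ ⧺ substEnv P x A Δ) ⊑ Δ')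
           (w : Δ' wf) → SmallerSorting ((Γ , x ∶ A) ⧺ Δ) C n →
           SmallerSorting Δ' (⟨ P / x ⟩[ A ] C) (suc (size-⊢ d + n + size-wf w))
  re-cut {Δ = Δ} d sub w (s , e , e<n) =
    s , Cut₄ {Δ = Δ} d e sub w , smaller-cut (size-⊢ d) (size-wf w) e<n

  cut₄-sorting : ∀ {Γ Δ Δ' P x A M C} (d : Γ ⊢ P ∶ A) (e : ((Γ , x ∶ A) ⧺ Δ) ⊢ M ∶ C)
                 (sub : (Γ ⧺ substEnv P x A Δ) ⊑ Δ') (w : Δ' wf) →
                 SmallerSorting ((Γ , x ∶ A) ⧺ Δ) C (size-⊢ e) ⊎ IsSort C →
                 SmallerSorting Δ' (substTy P x A C) (size-⊢ (Cut₄ {Δ = Δ} d e sub w))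
                 ⊎ IsSort (substTy P x A C)
  cut₄-sorting d e sub w (inj₂ (s , refl)) = inj₂ (s , refl)
  cut₄-sorting {Δ' = Δ'} {P} {x} {A} {C = C} d e sub w (inj₁ C-sorted) with sortView C
  ... | sort-view s   = inj₂ (s , refl)
  ... | other-view eq =
    inj₁ (subst (λ T → SmallerSorting Δ' T (size-⊢ (Cut₄ d e sub w))) (sym (eq P x A))
                (re-cut d sub w C-sorted))

  mutual
    term-sorting : ∀ {Γ M A} (d : Γ ⊢ M ∶ A) → SmallerSorting Γ A (size-⊢ d) ⊎ IsSort A
    term-sorting (sorted _ _)     = inj₂ (_ , refl)
    term-sorting (Πwf _ _ _)      = inj₂ (_ , refl)
    term-sorting (ΠR d e)         = inj₁ (_ , d , premise₁/₂ (size-⊢ d) (size-⊢ e))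
    term-sorting (select d _)     = inj₁ (raise-sorting (target-sorting d) (n<1+n (size-⍮ d)))
    term-sorting (convR d e _)    = inj₁ (_ , e , premise₂/₂ (size-⊢ d) (size-⊢ e))
    term-sorting (Cut₃ d e)       =
      inj₁ (raise-sorting (target-sorting e) (premise₂/₂ (size-⊢ d) (size-⍮ e)))
    term-sorting (Cut₄ d e sub w) = cut₄-sorting d e sub w (term-sorting e)

    source-sorting : ∀ {Γ B l C} (d : Γ ⍮ B ⊢ l ∶ C) → SmallerSorting Γ B (size-⍮ d)
    source-sorting (axiom d)        = _ , d , n<1+n (size-⊢ d)
    source-sorting (ΠL d e f)       = _ , d , premise₁/₃ (size-⊢ d) (size-⊢ e) (size-⍮ f)
    source-sorting (convR' d e _)   = raise-sorting (source-sorting d) (premise₁/₂ (size-⍮ d) (size-⊢ e))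
    source-sorting (convL d e _)    = _ , e , premise₂/₂ (size-⍮ d) (size-⊢ e)
    source-sorting (Cut₁ d e)       = raise-sorting (source-sorting d) (premise₁/₂ (size-⍮ d) (size-⍮ e))
    source-sorting (Cut₂ d e sub w) = re-cut d sub w (source-sorting e)

    target-sorting : ∀ {Γ B l C} (d : Γ ⍮ B ⊢ l ∶ C) → SmallerSorting Γ C (size-⍮ d)
    target-sorting (axiom d)        = _ , d , n<1+n (size-⊢ d)
    target-sorting (ΠL d e f)       =
      raise-sorting (target-sorting f) (premise₃/₃ (size-⊢ d) (size-⊢ e) (size-⍮ f))
    target-sorting (convR' d e _)   = _ , e , premise₂/₂ (size-⍮ d) (size-⊢ e)
    target-sorting (convL d e _)    = raise-sorting (target-sorting d) (premise₁/₂ (size-⍮ d) (size-⊢ e))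
    target-sorting (Cut₁ d e)       = raise-sorting (target-sorting e) (premise₂/₂ (size-⍮ d) (size-⍮ e))
    target-sorting (Cut₂ d e sub w) = re-cut d sub w (target-sorting e)

lemma3p3 : (𝒫 : PTSC) →
    (∀ {Γ : Env {𝒫}} {M A : Term 𝒫} (d : Γ ⊢ M ∶ A) →
        (M ⊆domₜ Γ)
      × (Σ (Γ wf) λ w → size-wf w < size-⊢ d)
      × ((Σ (PTSC.Sort 𝒫) λ s → Σ (Γ ⊢ A ∶ sort s) λ e → size-⊢ e < size-⊢ d)
         ⊎ IsSort A))
    ×
    (∀ {Γ : Env {𝒫}} {B : Term 𝒫} {l : Lst 𝒫} {C : Term 𝒫} (d : Γ ⍮ B ⊢ l ∶ C) →
        (l ⊆domₗ Γ)
      × (Σ (Γ wf) λ w → size-wf w < size-⍮ d)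
      × (Σ (PTSC.Sort 𝒫) λ s → Σ (Γ ⊢ B ∶ sort s) λ e → size-⊢ e < size-⍮ d)
      × (Σ (PTSC.Sort 𝒫) λ s' → Σ (Γ ⊢ C ∶ sort s') λ e → size-⊢ e < size-⍮ d))
lemma3p3 𝒫 =
    (λ d → term-scope d , term-wf d , term-sorting d)
  , (λ d → list-scope d , list-wf d , source-sorting d , target-sorting d)
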